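{- Let $G=(V,E)$ be a finite simple undirected graph. Let $G_0:=G$ and let $W_1,\dots,W_r$ be distinct subsets of $V$ such that for every $t\in\{1,\dots,r\}$, $W_t$ is a clique of $G_{t-1}$ with $|W_t|\ge2$ and $G_t:=G_{t-1}\mid W_t$. Let $F_0:=STAB(G)$ and $F_t:=\{x\in STAB(G)\mid x_{W_j}=1,\ j=1,\dots,t\}$ for $t\in\{1,\dots,r\}$. Then for every $t\in\{1,\dots,r\}$, the inequality $x_{W_t}\le 1$ is valid for $F_{t-1}$.
   Context: For a graph $H$ on vertex set $V$, $STAB(H)\subseteq\mathbb{R}^V$ is the convex hull of the characteristic vectors of the stable sets of $H$. For $x\in\mathbb{R}^V$ and $W\subseteq V$, $x_W=\sum_{v\in W}x_v$. For a graph $H=(V,E_H)$ and a clique $W$ of $H$ with $|W|\ge2$, the clique projection is $H\mid W=(V,E_H\cup\{uv\notin E_H\mid u\ne v,\ W\subseteq N_H(u)\cup N_H(v)\})$, where $N_H(u)$ is the neighborhood of $u$ in $H$.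
   Formalization: Points x of $STAB(G)$ and of $F_{t-1}$ are taken in ℚ^V, as rational convex combinations of characteristic vectors of stable sets, rather than in ℝ^V. -}

module Defs where

open import Data.Nat using (ℕ; zero; suc)
open import Data.Bool using (Bool; true; false; if_then_else_)
open import Data.Fin using (Fin)
open import Data.Fin.Subset using (Subset; _∈_)
open import Data.Vec using (lookup)
open import Data.List using (List; []; _∷_; map; foldr; allFin)
open import Data.List.Relation.Unary.All using (All)
open import Data.Product using (_×_; Σ; ∃; proj₁; proj₂)
open import Data.Sum using (_⊎_)
open import Relation.Binary.PropositionalEquality using (_≡_; _≢_)
open import Relation.Nullary using (¬_)
open import Data.Rational using (ℚ; 0ℚ; 1ℚ; _+_; _*_; _≤_)

record Graph (n : ℕ) : Set where
  field
    adj   : Fin n → Fin n → Bool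
    sym   : ∀ u v → adj u v ≡ adj v u
    irrefl : ∀ u → adj u u ≡ false

open Graph public

EdgeRel : ℕ → Set₁
EdgeRel n = Fin n → Fin n → Set

edges : ∀ {n} → Graph n → EdgeRel n
edges G u v = adj G u v ≡ true

_∣proj_ : ∀ {n} → EdgeRel n → Subset n → EdgeRel n
(H ∣proj W) u v = H u v ⊎ (u ≢ v × (∀ w → w ∈ W → H u w ⊎ H v w))

IsClique : ∀ {n} → EdgeRel n → Subset n → Set
IsClique H W = ∀ u v → u ∈ W → v ∈ W → u ≢ v → H u v

-- G_0 = G, G_t = G_{t-1} | W_t  (W indexed from 1; W 0 is unused)
Gseq : ∀ {n} → Graph n → (ℕ → Subset n) → ℕ → EdgeRel n
Gseq G W zero = edges G
Gseq G W (suc t) = Gseq G W t ∣proj W (suc t)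

IsStable : ∀ {n} → Graph n → Subset n → Set
IsStable G S = ∀ u v → u ∈ S → v ∈ S → ¬ edges G u v

χ : ∀ {n} → Subset n → Fin n → ℚ
χ S v = if lookup S v then 1ℚ else 0ℚ

Σv : ∀ {n} → (Fin n → ℚ) → ℚ
Σv {n} f = foldr _+_ 0ℚ (map f (allFin n))

xsum : ∀ {n} → Subset n → (Fin n → ℚ) → ℚ
xsum W x = Σv (λ v → χ W v * x v)

-- (rational points of) STAB(G): convex combinations of characteristic
-- vectors of stable sets, given by a finite list of (weight, stable set).
Σl : ∀ {A : Set} → (A → ℚ) → List A → ℚ
Σl f xs = foldr _+_ 0ℚ (map f xs)

InSTAB : ∀ {n} → Graph n → (Fin n → ℚ) → Set
InSTAB {n} G x =
  Σ (List (ℚ × Subset n)) λ c →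
    All (λ p → 0ℚ ≤ proj₁ p × IsStable G (proj₂ p)) c
    × Σl proj₁ c ≡ 1ℚ
    × (∀ v → x v ≡ Σl (λ p → proj₁ p * χ (proj₂ p) v) c)

-- Write x as a convex combination of characteristic vectors of stable sets of G.
-- By induction on t, every stable set S of positive weight stays stable in G_{t-1}.
-- A clique and a stable set share at most one vertex, so x_{W_t} ≤ 1; and if x_{W_t} = 1,
-- every such S meets W_t, say in w. A new edge uv of G_{t-1} ∣ W_t with u, v ∈ S would
-- make w adjacent to u or v, so S stays stable in G_t.
module Submission where

open import Defs hiding (sym)
open import Algebra.Bundles using (CommutativeMonoid)
import Algebra.Properties.CommutativeSemigroup as CommSemigroupProperties
open import Data.Bool using (true; false)
open import Data.Fin using (Fin; zero; suc; _≟_)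
open import Data.Fin.Properties using (suc-injective; 0≢1+n)
open import Data.Fin.Subset using (Subset; ∣_∣; _∩_; ⊥; inside; outside; Nonempty; Empty)
  renaming (_∈_ to _∈ₛ_)
open import Data.Fin.Subset.Properties using (Empty-unique; nonempty?; x∈p∩q⁻)
open import Data.List using (List; []; _∷_; foldr; allFin)
open import Data.List.Properties using (map-tabulate)
open import Data.List.Relation.Unary.All as All using (All; []; _∷_)
open import Data.Nat using (ℕ; _≤_; _∸_; zero; suc; s≤s; z≤n)
open import Data.Nat.Properties using (≤-refl; ≤-trans; <⇒≤; m∸n≤m)
open import Data.Product using (_×_; _,_; proj₁; proj₂)
open import Data.Rational using (ℚ; 0ℚ; 1ℚ; _+_; _*_; nonNegative) renaming (_≤_ to _≤ℚ_)
open import Data.Rational.Properties as ℚ using ()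
open import Data.Sum using (_⊎_; inj₁; inj₂)
open import Data.Vec using ([]; _∷_; here; there)
open import Function using (_∘_)
open import Relation.Binary.PropositionalEquality
  using (_≡_; _≢_; refl; sym; trans; cong; cong₂; subst; module ≡-Reasoning)
open import Relation.Nullary using (¬_; yes; no)
open import Relation.Nullary.Decidable using (decidable-stable)

open CommSemigroupProperties (CommutativeMonoid.commutativeSemigroup ℚ.+-0-commutativeMonoid)
  using () renaming (interchange to +-interchange)
open CommSemigroupProperties (CommutativeMonoid.commutativeSemigroup ℚ.*-1-commutativeMonoid)
  using () renaming (x∙yz≈y∙xz to *-left-comm)

private
  variable
    A B : Set
    n : ℕ

+-mono-≤-equality : ∀ {a b c d} → a ≤ℚ b → c ≤ℚ d → a + c ≡ b + d → a ≡ b × c ≡ d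
+-mono-≤-equality a≤b c≤d sum≡ =
  ℚ.≤-antisym a≤b (ℚ.≮⇒≥ (λ a<b → ℚ.<-irrefl sum≡ (ℚ.+-mono-<-≤ a<b c≤d))) ,
  ℚ.≤-antisym c≤d (ℚ.≮⇒≥ (λ c<d → ℚ.<-irrefl sum≡ (ℚ.+-mono-≤-< a≤b c<d)))

Σl-cong : ∀ {f g : A → ℚ} (xs : List A) → (∀ a → f a ≡ g a) → Σl f xs ≡ Σl g xs
Σl-cong []       f≗g = refl
Σl-cong (x ∷ xs) f≗g = cong₂ _+_ (f≗g x) (Σl-cong xs f≗g)

Σl-zero : (xs : List A) → Σl (λ _ → 0ℚ) xs ≡ 0ℚ
Σl-zero []       = refl
Σl-zero (x ∷ xs) = cong (0ℚ +_) (Σl-zero xs)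

Σl-+ : (f g : A → ℚ) (xs : List A) → Σl (λ a → f a + g a) xs ≡ Σl f xs + Σl g xs
Σl-+ f g []       = refl
Σl-+ f g (x ∷ xs) =
  trans (cong (f x + g x +_) (Σl-+ f g xs)) (+-interchange (f x) (g x) (Σl f xs) (Σl g xs))

Σl-*ˡ : (k : ℚ) (f : A → ℚ) (xs : List A) → Σl (λ a → k * f a) xs ≡ k * Σl f xs
Σl-*ˡ k f []       = sym (ℚ.*-zeroʳ k)
Σl-*ˡ k f (x ∷ xs) =
  trans (cong (k * f x +_) (Σl-*ˡ k f xs)) (sym (ℚ.*-distribˡ-+ k (f x) (Σl f xs)))

Σl-swap : (f : A → B → ℚ) (xs : List A) (ys : List B) →
  Σl (λ a → Σl (f a) ys) xs ≡ Σl (λ b → Σl (λ a → f a b) xs) ys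
Σl-swap f []       ys = sym (Σl-zero ys)
Σl-swap f (x ∷ xs) ys =
  trans (cong (Σl (f x) ys +_) (Σl-swap f xs ys))
        (sym (Σl-+ (f x) (λ b → Σl (λ a → f a b) xs) ys))

Σl-mono-≤ : ∀ {f g : A → ℚ} (xs : List A) → All (λ a → f a ≤ℚ g a) xs → Σl f xs ≤ℚ Σl g xs
Σl-mono-≤ []       []           = ℚ.≤-refl
Σl-mono-≤ (x ∷ xs) (fx≤gx ∷ ≤s) = ℚ.+-mono-≤ fx≤gx (Σl-mono-≤ xs ≤s)

Σl-mono-≤-equality : ∀ {f g : A → ℚ} (xs : List A) → All (λ a → f a ≤ℚ g a) xs →
  Σl f xs ≡ Σl g xs → All (λ a → f a ≡ g a) xs
Σl-mono-≤-equality []       []           _    = []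
Σl-mono-≤-equality (x ∷ xs) (fx≤gx ∷ ≤s) sum≡ =
  let fx≡gx , rest≡ = +-mono-≤-equality fx≤gx (Σl-mono-≤ xs ≤s) sum≡
  in fx≡gx ∷ Σl-mono-≤-equality xs ≤s rest≡

Σv-suc : (f : Fin (suc n) → ℚ) → Σv f ≡ f zero + Σv (f ∘ suc)
Σv-suc {n} f = cong (λ ys → f zero + foldr _+_ 0ℚ ys)
  (trans (map-tabulate suc f) (sym (map-tabulate (λ v → v) (f ∘ suc))))

χ-∩ : (W S : Subset n) (v : Fin n) → χ (W ∩ S) v ≡ χ W v * χ S v
χ-∩ (a ∷ W) (b ∷ S) (suc v) = χ-∩ W S v
χ-∩ (true  ∷ W) (true  ∷ S) zero = refl
χ-∩ (true  ∷ W) (false ∷ S) zero = refl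
χ-∩ (false ∷ W) (true  ∷ S) zero = refl
χ-∩ (false ∷ W) (false ∷ S) zero = refl

xsum-χ : (W S : Subset n) → xsum W (χ S) ≡ Σv (χ (W ∩ S))
xsum-χ {n} W S = Σl-cong (allFin n) (λ v → sym (χ-∩ W S v))

Σv-χ-⊥ : ∀ n → Σv (χ (⊥ {n})) ≡ 0ℚ
Σv-χ-⊥ zero    = refl
Σv-χ-⊥ (suc n) = trans (Σv-suc (χ (⊥ {suc n}))) (cong (0ℚ +_) (Σv-χ-⊥ n))

Σv-χ-subsingleton : (T : Subset n) → (∀ {u v} → u ∈ₛ T → v ∈ₛ T → u ≡ v) → Σv (χ T) ≤ℚ 1ℚ
Σv-χ-subsingleton []            _      = ℚ.nonNegative⁻¹ 1ℚ
Σv-χ-subsingleton (outside ∷ T) unique =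
  subst (_≤ℚ 1ℚ) (sym (trans (Σv-suc (χ (outside ∷ T))) (ℚ.+-identityˡ _)))
    (Σv-χ-subsingleton T (λ u∈T v∈T → suc-injective (unique (there u∈T) (there v∈T))))
Σv-χ-subsingleton {suc n} (inside ∷ T) unique = ℚ.≤-reflexive (begin
  Σv (χ (inside ∷ T))  ≡⟨ Σv-suc (χ (inside ∷ T)) ⟩
  1ℚ + Σv (χ T)        ≡⟨ cong (λ T′ → 1ℚ + Σv (χ T′)) T≡⊥ ⟩
  1ℚ + Σv (χ (⊥ {n}))  ≡⟨ cong (1ℚ +_) (Σv-χ-⊥ n) ⟩
  1ℚ                   ∎)
  where
  open ≡-Reasoning
  T≡⊥ : T ≡ ⊥
  T≡⊥ = Empty-unique (λ (v , v∈T) → 0≢1+n (unique here (there v∈T)))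

StableIn : EdgeRel n → Subset n → Set
StableIn H S = ∀ u v → u ∈ₛ S → v ∈ₛ S → ¬ H u v

clique∩stable-subsingleton : ∀ {H : EdgeRel n} {W S u v} → IsClique H W → StableIn H S →
  u ∈ₛ W ∩ S → v ∈ₛ W ∩ S → u ≡ v
clique∩stable-subsingleton {W = W} {S} {u} {v} clique stable u∈W∩S v∈W∩S
  with x∈p∩q⁻ W S u∈W∩S | x∈p∩q⁻ W S v∈W∩S
... | u∈W , u∈S | v∈W , v∈S =
  decidable-stable (u ≟ v) (λ u≢v → stable u v u∈S v∈S (clique u v u∈W v∈W u≢v))

xsum-clique-stable-≤1 : ∀ {H : EdgeRel n} {W S} → IsClique H W → StableIn H S →
  xsum W (χ S) ≤ℚ 1ℚ
xsum-clique-stable-≤1 {W = W} {S} clique stable = subst (_≤ℚ 1ℚ) (sym (xsum-χ W S))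
  (Σv-χ-subsingleton (W ∩ S) (clique∩stable-subsingleton clique stable))

xsum-disjoint : (W S : Subset n) → Empty (W ∩ S) → xsum W (χ S) ≡ 0ℚ
xsum-disjoint {n} W S empty =
  trans (xsum-χ W S) (trans (cong (Σv ∘ χ) (Empty-unique empty)) (Σv-χ-⊥ n))

stable-∣proj : ∀ {H : EdgeRel n} {W S} → StableIn H S → Nonempty (W ∩ S) →
  StableIn (H ∣proj W) S
stable-∣proj stable _ u v u∈S v∈S (inj₁ uv) = stable u v u∈S v∈S uv
stable-∣proj {W = W} {S} stable (w , w∈W∩S) u v u∈S v∈S (inj₂ (_ , W⊆Nu∪Nv))
  with x∈p∩q⁻ W S w∈W∩S
... | w∈W , w∈S with W⊆Nu∪Nv w w∈W
...   | inj₁ uw = stable u w u∈S w∈S uw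
...   | inj₂ vw = stable v w v∈S w∈S vw

Weighting : ℕ → Set
Weighting n = List (ℚ × Subset n)

StableSupport : EdgeRel n → Weighting n → Set
StableSupport H c = All (λ (l , S) → l ≡ 0ℚ ⊎ StableIn H S) c

weighted-xsum : Subset n → Weighting n → ℚ
weighted-xsum W c = Σl (λ (l , S) → l * xsum W (χ S)) c

xsum-convex : (W : Subset n) {x : Fin n → ℚ} (c : Weighting n) →
  (∀ v → x v ≡ Σl (λ (l , S) → l * χ S v) c) →
  xsum W x ≡ weighted-xsum W c
xsum-convex {n} W {x} c x≡Σ = begin
  Σl (λ v → χ W v * x v) vs
    ≡⟨ Σl-cong vs (λ v → cong (χ W v *_) (x≡Σ v)) ⟩
  Σl (λ v → χ W v * Σl (λ (l , S) → l * χ S v) c) vs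
    ≡⟨ Σl-cong vs (λ v → sym (Σl-*ˡ (χ W v) _ c)) ⟩
  Σl (λ v → Σl (λ (l , S) → χ W v * (l * χ S v)) c) vs
    ≡⟨ Σl-swap (λ v (l , S) → χ W v * (l * χ S v)) vs c ⟩
  Σl (λ (l , S) → Σl (λ v → χ W v * (l * χ S v)) vs) c
    ≡⟨ Σl-cong c (λ (l , S) → Σl-cong vs (λ v → *-left-comm (χ W v) l (χ S v))) ⟩
  Σl (λ (l , S) → Σl (λ v → l * (χ W v * χ S v)) vs) c
    ≡⟨ Σl-cong c (λ (l , S) → Σl-*ˡ l (λ v → χ W v * χ S v) vs) ⟩
  Σl (λ (l , S) → l * xsum W (χ S)) c ∎
  where
  open ≡-Reasoning
  vs : List (Fin n)
  vs = allFin n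

module StableCombination {c : Weighting n}
  (nonneg : All (λ (l , _) → 0ℚ ≤ℚ l) c) (total : Σl proj₁ c ≡ 1ℚ) where

  private
    variable
      H : EdgeRel n
      W : Subset n

  weighted-term-≤ : IsClique H W → StableSupport H c →
    All (λ (l , S) → l * xsum W (χ S) ≤ℚ l) c
  weighted-term-≤ {H} {W} clique support =
    All.zipWith (λ (0≤l , s) → bound 0≤l s) (nonneg , support)
    where
    bound : ∀ {l S} → 0ℚ ≤ℚ l → l ≡ 0ℚ ⊎ StableIn H S → l * xsum W (χ S) ≤ℚ l
    bound {S = S} _ (inj₁ refl) = ℚ.≤-reflexive (ℚ.*-zeroˡ (xsum W (χ S)))
    bound {l} 0≤l (inj₂ stable) = subst (l * _ ≤ℚ_) (ℚ.*-identityʳ l)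
      (ℚ.*-monoˡ-≤-nonNeg l {{nonNegative 0≤l}} (xsum-clique-stable-≤1 clique stable))

  weighted-xsum-≤1 : IsClique H W → StableSupport H c → weighted-xsum W c ≤ℚ 1ℚ
  weighted-xsum-≤1 {W = W} clique support =
    subst (weighted-xsum W c ≤ℚ_) total (Σl-mono-≤ c (weighted-term-≤ clique support))

  weighted-xsum≡1⇒StableSupport-∣proj : IsClique H W → StableSupport H c →
    weighted-xsum W c ≡ 1ℚ → StableSupport (H ∣proj W) c
  weighted-xsum≡1⇒StableSupport-∣proj {H} {W} clique support tight =
    All.zipWith (λ (full , s) → survive full s)
      (Σl-mono-≤-equality c (weighted-term-≤ clique support) (trans tight (sym total)) , support)
    where
    survive : ∀ {l S} → l * xsum W (χ S) ≡ l → l ≡ 0ℚ ⊎ StableIn H S →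
      l ≡ 0ℚ ⊎ StableIn (H ∣proj W) S
    survive _ (inj₁ l≡0) = inj₁ l≡0
    survive {l} {S} full (inj₂ stable) with nonempty? (W ∩ S)
    ... | yes meets   = inj₂ (stable-∣proj stable meets)
    ... | no disjoint = inj₁ (begin
      l                  ≡⟨ sym full ⟩
      l * xsum W (χ S)   ≡⟨ cong (l *_) (xsum-disjoint W S disjoint) ⟩
      l * 0ℚ             ≡⟨ ℚ.*-zeroʳ l ⟩
      0ℚ                 ∎)
      where open ≡-Reasoning

corollary1 : ∀ {n} (G : Graph n) (r : ℕ) (W : ℕ → Subset n) →
    (∀ i j → 1 ≤ i → i ≤ r → 1 ≤ j → j ≤ r → i ≢ j → W i ≢ W j) →
    (∀ t → 1 ≤ t → t ≤ r → IsClique (Gseq G W (t ∸ 1)) (W t) × 2 ≤ ∣ W t ∣) →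
    ∀ t → 1 ≤ t → t ≤ r →
    ∀ (x : Fin n → ℚ) → InSTAB G x →
    (∀ j → 1 ≤ j → j ≤ t ∸ 1 → xsum (W j) x ≡ 1ℚ) →
    xsum (W t) x ≤ℚ 1ℚ
corollary1 G _ W _ cliques t 1≤t t≤r _ (c , weights , total , x≡Σ) tight =
  subst (_≤ℚ 1ℚ) (sym (xsum-convex (W t) c x≡Σ))
    (weighted-xsum-≤1 (proj₁ (cliques t 1≤t t≤r)) (support (t ∸ 1) ≤-refl))
  where
  open StableCombination (All.map proj₁ weights) total
  support : ∀ k → k ≤ t ∸ 1 → StableSupport (Gseq G W k) c
  support zero    _       = All.map (inj₂ ∘ proj₂) weights
  support (suc k) 1+k≤t-1 = weighted-xsum≡1⇒StableSupport-∣proj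
    (proj₁ (cliques (suc k) (s≤s z≤n) (≤-trans 1+k≤t-1 (≤-trans (m∸n≤m t 1) t≤r))))
    (support k (<⇒≤ 1+k≤t-1))
    (trans (sym (xsum-convex (W (suc k)) c x≡Σ)) (tight (suc k) (s≤s z≤n) 1+k≤t-1))
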